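{- Let $q$ be an odd prime power with $q\equiv 1\pmod 3$, let $m=(q-1)/3$, and let $\gamma$ be a generator of the multiplicative group $\mathbf{F}_q^*$. For each $k\in\{0,1,\dots,m-1\}$, define elements $a,b,c\in\mathbf{F}_q$ by $$a=\frac{\gamma^{2m}+\gamma^{m+6k+2}+\gamma^{3k+1}}{3\gamma^{m+3k+1}},\qquad b=\frac{\gamma^{2m+3k+1}+\gamma^{m+6k+2}+1}{3\gamma^{m+3k+1}},\qquad c=\frac{\gamma^{6k+2}+\gamma^{3k+1}+1}{3\gamma^{3k+1}}.$$ Then the polynomial $g(x)=ax^{2m+1}+bx^{m+1}+cx$ is a permutation polynomial over $\mathbf{F}_q$, and the permutation of $\mathbf{F}_q$ it induces is an involution with exactly $m+1$ fixed points.
   Context: $\mathbf{F}_q$ denotes the finite field with $q$ elements. A permutation polynomial over $\mathbf{F}_q$ is a polynomial $g\in\mathbf{F}_q[x]$ whose associated map $\mathbf{F}_q\to\mathbf{F}_q$, $x\mapsto g(x)$, is a bijection; it is involutory if $g(g(x))=x$ for all $x\in\mathbf{F}_q$. -}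

module Defs where

open import Level using (0ℓ)
open import Data.Nat as ℕ using (ℕ; zero; suc)
open import Data.Fin using (Fin)
open import Data.Product using (∃)
open import Relation.Binary.PropositionalEquality using (_≡_; _≢_)
open import Relation.Nullary using (¬_)
open import Algebra.Structures using (IsCommutativeRing)
open import Function.Bundles using (_↔_)

record FiniteField : Set₁ where
  infixl 7 _*_
  infixl 6 _+_
  field
    Carrier : Set
    _+_ _*_ : Carrier → Carrier → Carrier
    -_      : Carrier → Carrier
    0# 1#   : Carrier
    isCommutativeRing : IsCommutativeRing _≡_ _+_ _*_ -_ 0# 1#
    0≢1     : 0# ≢ 1#
    _⁻¹     : Carrier → Carrier
    inverseʳ : ∀ x → x ≢ 0# → x * (x ⁻¹) ≡ 1#
    card    : ℕ
    enum    : Fin card ↔ Carrier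

  infixr 8 _^_
  _^_ : Carrier → ℕ → Carrier
  x ^ zero  = 1#
  x ^ suc n = x * (x ^ n)

  -- division (denominators used below are nonzero)
  infixl 7 _÷_
  _÷_ : Carrier → Carrier → Carrier
  x ÷ y = x * (y ⁻¹)

  3# : Carrier
  3# = 1# + 1# + 1#

  IsGenerator : Carrier → Set
  IsGenerator γ = γ ≢ 0# × (∀ x → x ≢ 0# → ∃ λ i → γ ^ i ≡ x)
    where open import Data.Product using (_×_)

  coefA : Carrier → ℕ → ℕ → Carrier
  coefA γ m k =
    (γ ^ (2 ℕ.* m) + γ ^ (m ℕ.+ 6 ℕ.* k ℕ.+ 2) + γ ^ (3 ℕ.* k ℕ.+ 1))
      ÷ (3# * γ ^ (m ℕ.+ 3 ℕ.* k ℕ.+ 1))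

  coefB : Carrier → ℕ → ℕ → Carrier
  coefB γ m k =
    (γ ^ (2 ℕ.* m ℕ.+ 3 ℕ.* k ℕ.+ 1) + γ ^ (m ℕ.+ 6 ℕ.* k ℕ.+ 2) + 1#)
      ÷ (3# * γ ^ (m ℕ.+ 3 ℕ.* k ℕ.+ 1))

  coefC : Carrier → ℕ → ℕ → Carrier
  coefC γ m k =
    (γ ^ (6 ℕ.* k ℕ.+ 2) + γ ^ (3 ℕ.* k ℕ.+ 1) + 1#)
      ÷ (3# * γ ^ (3 ℕ.* k ℕ.+ 1))

  gPoly : Carrier → ℕ → ℕ → Carrier → Carrier
  gPoly γ m k x =
    coefA γ m k * x ^ (2 ℕ.* m ℕ.+ 1) + coefB γ m k * x ^ (m ℕ.+ 1) + coefC γ m k * x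

-- Put ω = γ^m, a primitive cube root of unity, and t = γ^(3k+1). For x ≠ 0 the power x^m is
-- one of 1, ω, ω², and g(x) = L(x^m)·x with L(u) = a u² + b u + c. The coefficients a, b, c
-- are those of the quadratic interpolating L(1) = t, L(ω) = t⁻¹, L(ω²) = 1, which is checked
-- by computing modulo 1 + ω + ω² = 0. As t^m = ω, g maps {x^m = 1} onto {x^m = ω} by x ↦ t x
-- and back by x ↦ t⁻¹ x, and fixes {x^m = ω²} = {γ^(3j+2)} pointwise; since t ≠ 1 these and 0
-- are all the fixed points.
module Submission where

open import Defs
open import Level using (0ℓ)
open import Data.Nat as ℕ using (ℕ; zero; suc; s≤s; z≤n; _∸_; _/_; _%_; _<_; NonZero)
import Data.Nat.Properties as ℕₚ
open ℕₚ using (anyUpTo?)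
open import Data.Nat.Induction using (<-rec)
open import Data.Nat.DivMod using (m≡m%n+[m/n]*n; m%n<n; m<n*o⇒m/o<n; m/n*n≡m)
open import Data.Nat.Divisibility using (_∣_; divides)
open import Data.Nat.Tactic.RingSolver using () renaming (solve to ℕ-solve)
open import Data.Fin using (Fin; zero; suc; toℕ; fromℕ<)
open import Data.Fin.Properties using (inj⇒≟; pigeonhole; toℕ<n; toℕ-fromℕ<; toℕ-injective)
open import Data.Fin.Permutation using (↔⇒≡)
open import Data.List using (_∷_; [])
open import Data.Maybe using (nothing)
open import Data.Product using (Σ; _×_; _,_; ∃; proj₁; proj₂)
open import Data.Unit.Polymorphic using (tt)
open import Relation.Nullary using (¬_; yes; no; contradiction)
open import Relation.Nullary.Decidable using (decidable-stable; _×-dec_)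
open import Relation.Unary using (Decidable; Irrelevant)
open import Relation.Binary.Definitions using (DecidableEquality; tri<; tri≈; tri>)
open import Relation.Binary.PropositionalEquality
open import Axiom.UniquenessOfIdentityProofs using (module Decidable⇒UIP)
open import Algebra.Bundles using (CommutativeSemiring)
open import Algebra.Structures using (IsCommutativeRing)
open import Algebra.Consequences.Propositional using (selfInverse⇒bijective)
open import Function using (_∘_)
open import Function.Bundles using (_↔_; mk↔ₛ′; Injection)
open import Function.Definitions using (Bijective)
open import Function.Properties.Inverse using (↔-sym; ↔-trans; Inverse⇒Injection)
open import Function.Related.TypeIsomorphisms using (×-identityʳ)

Least : (ℕ → Set) → Set
Least P = ∃ λ n → P n × (∀ {j} → j < n → ¬ P j)

least-witness : {P : ℕ → Set} → Decidable P → ∀ n → P n → Least P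
least-witness {P} P? = <-rec (λ n → P n → Least P) search
  where
  search : ∀ n → (∀ {j} → j < n → P j → Least P) → P n → Least P
  search n smaller pn with anyUpTo? P? n
  ... | yes (j , j<n , pj) = smaller j<n pj
  ... | no none            = n , pn , λ j<n pj → none (_ , j<n , pj)

3∣n∸1 : ∀ {n} → n % 3 ≡ 1 → 3 ∣ n ∸ 1
3∣n∸1 {n} n%3≡1 = divides (n / 3) (cong (_∸ 1) (trans (m≡m%n+[m/n]*n n 3) (cong (ℕ._+ n / 3 ℕ.* 3) n%3≡1)))

module FieldProperties (F : FiniteField) where
  open FiniteField F
  open IsCommutativeRing isCommutativeRing
    using (isCommutativeSemiring; *-comm; *-assoc; zeroˡ; zeroʳ; *-identityˡ; *-identityʳ; +-identityˡ; +-identityʳ)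
  open ≡-Reasoning

  commutativeSemiring : CommutativeSemiring 0ℓ 0ℓ
  commutativeSemiring = record { isCommutativeSemiring = isCommutativeSemiring }

  open import Algebra.Solver.Ring.NaturalCoefficients commutativeSemiring (λ _ _ → nothing) public
    using (Polynomial; solve; _:=_; con; _:+_; _:*_; _:^_)

  open Injection (Inverse⇒Injection (↔-sym enum)) public
    using () renaming (to to index; injective to index-injective)

  infix 4 _≟_
  _≟_ : DecidableEquality Carrier
  _≟_ = inj⇒≟ (Inverse⇒Injection (↔-sym enum))

  inverseˡ : ∀ x → x ≢ 0# → x ⁻¹ * x ≡ 1#
  inverseˡ x x≢0 = trans (*-comm (x ⁻¹) x) (inverseʳ x x≢0)

  *-cancelˡ : ∀ {z x y} → z ≢ 0# → z * x ≡ z * y → x ≡ y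
  *-cancelˡ {z} {x} {y} z≢0 zx≡zy = begin
    x               ≡⟨ *-identityˡ x ⟨
    1# * x          ≡⟨ cong (_* x) (inverseˡ z z≢0) ⟨
    z ⁻¹ * z * x    ≡⟨ *-assoc (z ⁻¹) z x ⟩
    z ⁻¹ * (z * x)  ≡⟨ cong (z ⁻¹ *_) zx≡zy ⟩
    z ⁻¹ * (z * y)  ≡⟨ *-assoc (z ⁻¹) z y ⟨
    z ⁻¹ * z * y    ≡⟨ cong (_* y) (inverseˡ z z≢0) ⟩
    1# * y          ≡⟨ *-identityˡ y ⟩
    y               ∎

  *-cancelʳ : ∀ {z x y} → z ≢ 0# → x * z ≡ y * z → x ≡ y
  *-cancelʳ {z} {x} {y} z≢0 xz≡yz = *-cancelˡ z≢0 (trans (*-comm z x) (trans xz≡yz (*-comm y z)))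

  x*y≢0 : ∀ {x y} → x ≢ 0# → y ≢ 0# → x * y ≢ 0#
  x*y≢0 {x} x≢0 y≢0 xy≡0 = y≢0 (*-cancelˡ x≢0 (trans xy≡0 (sym (zeroʳ x))))

  x*x≡0⇒x≡0 : ∀ {x} → x * x ≡ 0# → x ≡ 0#
  x*x≡0⇒x≡0 {x} xx≡0 = decidable-stable (x ≟ 0#) (λ x≢0 → x*y≢0 x≢0 x≢0 xx≡0)

  ^-distribˡ-+-* : ∀ x a b → x ^ (a ℕ.+ b) ≡ x ^ a * x ^ b
  ^-distribˡ-+-* x zero    b = sym (*-identityˡ (x ^ b))
  ^-distribˡ-+-* x (suc a) b = trans (cong (x *_) (^-distribˡ-+-* x a b)) (sym (*-assoc x (x ^ a) (x ^ b)))

  ^-*-assoc : ∀ x a b → (x ^ a) ^ b ≡ x ^ (a ℕ.* b)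
  ^-*-assoc x a zero    = cong (x ^_) (sym (ℕₚ.*-zeroʳ a))
  ^-*-assoc x a (suc b) = begin
    x ^ a * (x ^ a) ^ b     ≡⟨ cong (x ^ a *_) (^-*-assoc x a b) ⟩
    x ^ a * x ^ (a ℕ.* b)   ≡⟨ ^-distribˡ-+-* x a (a ℕ.* b) ⟨
    x ^ (a ℕ.+ a ℕ.* b)     ≡⟨ cong (x ^_) (ℕₚ.*-suc a b) ⟨
    x ^ (a ℕ.* suc b)       ∎

  ^-comm : ∀ x a b → (x ^ a) ^ b ≡ (x ^ b) ^ a
  ^-comm x a b = trans (^-*-assoc x a b) (trans (cong (x ^_) (ℕₚ.*-comm a b)) (sym (^-*-assoc x b a)))

  ^-distribʳ-* : ∀ x y n → (x * y) ^ n ≡ x ^ n * y ^ n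
  ^-distribʳ-* x y zero    = sym (*-identityˡ 1#)
  ^-distribʳ-* x y (suc n) = trans (cong (x * y *_) (^-distribʳ-* x y n))
    (solve 4 (λ x y p q → x :* y :* (p :* q) := x :* p :* (y :* q)) refl x y (x ^ n) (y ^ n))

  1^n≡1 : ∀ n → 1# ^ n ≡ 1#
  1^n≡1 zero    = refl
  1^n≡1 (suc n) = trans (*-identityˡ (1# ^ n)) (1^n≡1 n)

  x^n≢0 : ∀ {x} n → x ≢ 0# → x ^ n ≢ 0#
  x^n≢0 zero    x≢0 = 0≢1 ∘ sym
  x^n≢0 (suc n) x≢0 = x*y≢0 x≢0 (x^n≢0 n x≢0)

  x^n≡x^[n%p] : ∀ {x} p .{{_ : NonZero p}} → x ^ p ≡ 1# → ∀ n → x ^ n ≡ x ^ (n % p)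
  x^n≡x^[n%p] {x} p x^p≡1 n = begin
    x ^ n                                 ≡⟨ cong (x ^_) (m≡m%n+[m/n]*n n p) ⟩
    x ^ (n % p ℕ.+ n / p ℕ.* p)           ≡⟨ ^-distribˡ-+-* x (n % p) (n / p ℕ.* p) ⟩
    x ^ (n % p) * x ^ (n / p ℕ.* p)       ≡⟨ cong (λ e → x ^ (n % p) * x ^ e) (ℕₚ.*-comm (n / p) p) ⟩
    x ^ (n % p) * x ^ (p ℕ.* (n / p))     ≡⟨ cong (x ^ (n % p) *_) (^-*-assoc x p (n / p)) ⟨
    x ^ (n % p) * (x ^ p) ^ (n / p)       ≡⟨ cong (λ y → x ^ (n % p) * y ^ (n / p)) x^p≡1 ⟩
    x ^ (n % p) * 1# ^ (n / p)            ≡⟨ cong (x ^ (n % p) *_) (1^n≡1 (n / p)) ⟩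
    x ^ (n % p) * 1#                      ≡⟨ *-identityʳ (x ^ (n % p)) ⟩
    x ^ (n % p)                           ∎

  x^i≡x^j⇒x^[j∸i]≡1 : ∀ {x i j} → x ≢ 0# → i ℕ.≤ j → x ^ i ≡ x ^ j → x ^ (j ∸ i) ≡ 1#
  x^i≡x^j⇒x^[j∸i]≡1 {x} {i} {j} x≢0 i≤j x^i≡x^j = *-cancelˡ (x^n≢0 i x≢0) (begin
    x ^ i * x ^ (j ∸ i)   ≡⟨ ^-distribˡ-+-* x i (j ∸ i) ⟨
    x ^ (i ℕ.+ (j ∸ i))   ≡⟨ cong (x ^_) (ℕₚ.m+[n∸m]≡n i≤j) ⟩
    x ^ j                 ≡⟨ x^i≡x^j ⟨
    x ^ i                 ≡⟨ *-identityʳ (x ^ i) ⟨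
    x ^ i * 1#            ∎)

  module _ {P : Carrier → Set} (P-irrelevant : Irrelevant P) (P0 : P 0#)
           {n : ℕ} (e : ℕ → Carrier)
           (e≢0 : ∀ i → e i ≢ 0#)
           (e-injective : ∀ {i j} → i < n → j < n → e i ≡ e j → i ≡ j)
           (P-e : ∀ {i} → i < n → P (e i))
           (e-onto : ∀ x → x ≢ 0# → P x → ∃ λ i → i < n × e i ≡ x) where

    private
      Σ-≡ : ∀ {x y} {px : P x} {py : P y} → x ≡ y → (x , px) ≡ (y , py)
      Σ-≡ refl = cong (_ ,_) (P-irrelevant _ _)

      to : Fin (suc n) → Σ Carrier P
      to zero    = 0# , P0
      to (suc i) = e (toℕ i) , P-e (toℕ<n i)

      from : Σ Carrier P → Fin (suc n)
      from (x , px) with x ≟ 0#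
      ... | yes _   = zero
      ... | no x≢0  = suc (fromℕ< (proj₁ (proj₂ (e-onto x x≢0 px))))

      to∘from : ∀ y → to (from y) ≡ y
      to∘from (x , px) with x ≟ 0#
      ... | yes x≡0 = Σ-≡ (sym x≡0)
      ... | no x≢0 with e-onto x x≢0 px
      ...   | i , i<n , eᵢ≡x = Σ-≡ (trans (cong e (toℕ-fromℕ< i<n)) eᵢ≡x)

      from∘to : ∀ i → from (to i) ≡ i
      from∘to zero with 0# ≟ 0#
      ... | yes _   = refl
      ... | no 0≢0  = contradiction refl 0≢0
      from∘to (suc i) with e (toℕ i) ≟ 0#
      ... | yes eᵢ≡0 = contradiction eᵢ≡0 (e≢0 (toℕ i))
      ... | no eᵢ≢0 with e-onto _ eᵢ≢0 (P-e (toℕ<n i))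
      ...   | j , j<n , eⱼ≡eᵢ = cong suc (toℕ-injective
                (trans (toℕ-fromℕ< j<n) (e-injective j<n (toℕ<n i) eⱼ≡eᵢ)))

    zero∪enumeration↔ : Fin (suc n) ↔ Σ Carrier P
    zero∪enumeration↔ = mk↔ₛ′ to from to∘from from∘to

  module CubeRoot {ω : Carrier} (ω³≡1 : ω ^ 3 ≡ 1#) (ω≢1 : ω ≢ 1#) where

    ω≢0 : ω ≢ 0#
    ω≢0 ω≡0 = 0≢1 (begin
      0#      ≡⟨ zeroˡ (ω ^ 2) ⟨
      0# * ω ^ 2 ≡⟨ cong (_* ω ^ 2) ω≡0 ⟨
      ω ^ 3   ≡⟨ ω³≡1 ⟩
      1#      ∎)

    1+ω+ω²≡0 : 1# + ω + ω ^ 2 ≡ 0#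
    1+ω+ω²≡0 = decidable-stable (1# + ω + ω ^ 2 ≟ 0#) λ Φ≢0 → ω≢1 (*-cancelʳ Φ≢0 (begin
      ω * (1# + ω + ω ^ 2)    ≡⟨ solve 1 (λ w → w :* (con 1 :+ w :+ w :^ 2) := w :^ 3 :+ w :+ w :^ 2) refl ω ⟩
      ω ^ 3 + ω + ω ^ 2       ≡⟨ cong (λ z → z + ω + ω ^ 2) ω³≡1 ⟩
      1# + ω + ω ^ 2          ≡⟨ solve 1 (λ w → con 1 :+ w :+ w :^ 2 := con 1 :* (con 1 :+ w :+ w :^ 2)) refl ω ⟩
      1# * (1# + ω + ω ^ 2)   ∎))

    data CubeRootOfUnity (u : Carrier) : Set where
      is-1  : u ≡ 1#    → CubeRootOfUnity u
      is-ω  : u ≡ ω     → CubeRootOfUnity u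
      is-ω² : u ≡ ω ^ 2 → CubeRootOfUnity u

    ω^n-cubeRoot : ∀ n → CubeRootOfUnity (ω ^ n)
    ω^n-cubeRoot zero = is-1 refl
    ω^n-cubeRoot (suc n) with ω^n-cubeRoot n
    ... | is-1 ωⁿ≡1  = is-ω (trans (cong (ω *_) ωⁿ≡1) (*-identityʳ ω))
    ... | is-ω ωⁿ≡ω  = is-ω² (cong (ω *_) (trans ωⁿ≡ω (sym (*-identityʳ ω))))
    ... | is-ω² ωⁿ≡ω² = is-1 (trans (cong (ω *_) ωⁿ≡ω²) ω³≡1)

    3≢0 : 3# ≢ 0#
    3≢0 3≡0 = ω≢1 (begin
      ω                  ≡⟨ +-identityʳ ω ⟨
      ω + 0#             ≡⟨ cong (ω +_) 3≡0 ⟨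
      ω + 3#             ≡⟨ solve 1 (λ w → w :+ (con 1 :+ con 1 :+ con 1) := w :+ con 1 :+ con 1 :+ con 1) refl ω ⟩
      ω + 1# + 1# + 1#   ≡⟨ cong (_+ 1#) (x*x≡0⇒x≡0 square≡0) ⟩
      0# + 1#            ≡⟨ +-identityˡ 1# ⟩
      1#                 ∎)
      where
      square≡0 : (ω + 1# + 1#) * (ω + 1# + 1#) ≡ 0#
      square≡0 = begin
        (ω + 1# + 1#) * (ω + 1# + 1#)    ≡⟨ solve 1 (λ w → (w :+ con 1 :+ con 1) :* (w :+ con 1 :+ con 1)
                                                := (con 1 :+ w :+ w :^ 2) :+ (con 1 :+ con 1 :+ con 1) :* w
                                                   :+ (con 1 :+ con 1 :+ con 1)) refl ω ⟩
        (1# + ω + ω ^ 2) + 3# * ω + 3#   ≡⟨ cong₂ (λ Φ c → Φ + c * ω + c) 1+ω+ω²≡0 3≡0 ⟩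
        0# + 0# * ω + 0#                 ≡⟨ trans (+-identityʳ _) (trans (+-identityˡ _) (zeroˡ ω)) ⟩
        0#                               ∎

    ω^[r+j*3]≡ω^r : ∀ r j → ω ^ (r ℕ.+ j ℕ.* 3) ≡ ω ^ r
    ω^[r+j*3]≡ω^r r j = begin
      ω ^ (r ℕ.+ j ℕ.* 3)     ≡⟨ ^-distribˡ-+-* ω r (j ℕ.* 3) ⟩
      ω ^ r * ω ^ (j ℕ.* 3)   ≡⟨ cong (ω ^ r *_) (^-*-assoc ω j 3) ⟨
      ω ^ r * (ω ^ j) ^ 3     ≡⟨ cong (ω ^ r *_) (^-comm ω j 3) ⟩
      ω ^ r * (ω ^ 3) ^ j     ≡⟨ cong (λ z → ω ^ r * z ^ j) ω³≡1 ⟩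
      ω ^ r * 1# ^ j          ≡⟨ cong (ω ^ r *_) (1^n≡1 j) ⟩
      ω ^ r * 1#              ≡⟨ *-identityʳ (ω ^ r) ⟩
      ω ^ r                   ∎

    ω^r≡ω²⇒r≡2 : ∀ {r} → r < 3 → ω ^ r ≡ ω ^ 2 → r ≡ 2
    ω^r≡ω²⇒r≡2 {0} _ 1≡ω² = contradiction (begin
      ω           ≡⟨ *-identityʳ ω ⟨
      ω * 1#      ≡⟨ cong (ω *_) 1≡ω² ⟩
      ω ^ 3       ≡⟨ ω³≡1 ⟩
      1#          ∎) ω≢1
    ω^r≡ω²⇒r≡2 {1} _ ω¹≡ω² = contradiction (trans (sym (*-identityʳ ω)) (sym (*-cancelˡ ω≢0 ω¹≡ω²))) ω≢1
    ω^r≡ω²⇒r≡2 {2} _ _     = refl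
    ω^r≡ω²⇒r≡2 {suc (suc (suc _))} (s≤s (s≤s (s≤s ())))

  module Interpolation {ω t : Carrier}
                       (1+ω+ω²≡0 : 1# + ω + ω ^ 2 ≡ 0#) (3≢0 : 3# ≢ 0#) (ω≢0 : ω ≢ 0#) (t≢0 : t ≢ 0#) where

    A B C D : Carrier
    A = ω ^ 2 + ω * t ^ 2 + t
    B = ω ^ 2 * t + ω * t ^ 2 + 1#
    C = t ^ 2 + t + 1#
    D = 3# * (ω * t)

    -- the quadratic taking the values t, t⁻¹, 1 at the cube roots of unity 1, ω, ω²
    multiplier : Carrier → Carrier
    multiplier u = A ÷ D * u ^ 2 + B ÷ D * u + C ÷ (3# * t)

    private
      module Syntax {n} (w s : Polynomial n) where
        Φ′ A′ B′ C′ D′ : Polynomial n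
        Φ′ = con 1 :+ w :+ w :^ 2
        A′ = w :^ 2 :+ w :* s :^ 2 :+ s
        B′ = w :^ 2 :* s :+ w :* s :^ 2 :+ con 1
        C′ = s :^ 2 :+ s :+ con 1
        D′ = (con 1 :+ con 1 :+ con 1) :* (w :* s)

      D≢0 : D ≢ 0#
      D≢0 = x*y≢0 3≢0 (x*y≢0 ω≢0 t≢0)

      ≡-modulo-Φ : ∀ {X Y} Q R → X + (1# + ω + ω ^ 2) * Q ≡ Y + (1# + ω + ω ^ 2) * R → X ≡ Y
      ≡-modulo-Φ {X} {Y} Q R eq = begin
        X                            ≡⟨ absorb X Q ⟩
        X + (1# + ω + ω ^ 2) * Q     ≡⟨ eq ⟩
        Y + (1# + ω + ω ^ 2) * R     ≡⟨ absorb Y R ⟨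
        Y                            ∎
        where
        absorb : ∀ Z P → Z ≡ Z + (1# + ω + ω ^ 2) * P
        absorb Z P = sym (trans (cong (λ Φ → Z + Φ * P) 1+ω+ω²≡0) (trans (cong (Z +_) (zeroˡ P)) (+-identityʳ Z)))

      multiplier*D : ∀ u → multiplier u * D ≡ A * u ^ 2 + B * u + C * ω
      multiplier*D u = begin
        multiplier u * D
          ≡⟨ solve 9 (λ A B C u w s d e i → (A :* d :* u :^ 2 :+ B :* d :* u :+ C :* e) :* (i :* (w :* s))
                        := (A :* u :^ 2 :+ B :* u) :* ((i :* (w :* s)) :* d) :+ C :* w :* ((i :* s) :* e))
               refl A B C u ω t (D ⁻¹) ((3# * t) ⁻¹) 3# ⟩
        (A * u ^ 2 + B * u) * (D * D ⁻¹) + C * ω * (3# * t * (3# * t) ⁻¹)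
          ≡⟨ cong₂ (λ p q → (A * u ^ 2 + B * u) * p + C * ω * q) (inverseʳ D D≢0) (inverseʳ (3# * t) (x*y≢0 3≢0 t≢0)) ⟩
        (A * u ^ 2 + B * u) * 1# + C * ω * 1#
          ≡⟨ solve 5 (λ A B C u w → (A :* u :^ 2 :+ B :* u) :* con 1 :+ C :* w :* con 1
                        := A :* u :^ 2 :+ B :* u :+ C :* w) refl A B C u ω ⟩
        A * u ^ 2 + B * u + C * ω
          ∎

    multiplier-1 : multiplier 1# ≡ t
    multiplier-1 = *-cancelʳ D≢0 (trans (multiplier*D 1#) (≡-modulo-Φ 1# (t + 1# + 1#)
      (solve 2 (λ w s → let open Syntax w s in
                  A′ :* con 1 :^ 2 :+ B′ :* con 1 :+ C′ :* w :+ Φ′ :* con 1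
               := s :* D′ :+ Φ′ :* (s :+ con 1 :+ con 1)) refl ω t)))

    multiplier-ω : multiplier ω * t ≡ 1#
    multiplier-ω = *-cancelʳ D≢0 (begin
      multiplier ω * t * D                     ≡⟨ solve 3 (λ μ s d → μ :* s :* d := μ :* d :* s) refl (multiplier ω) t D ⟩
      multiplier ω * D * t                     ≡⟨ cong (_* t) (multiplier*D ω) ⟩
      (A * ω ^ 2 + B * ω + C * ω) * t          ≡⟨ ≡-modulo-Φ (ω * t) (ω ^ 2 * t + ω * t ^ 3 + ω * t ^ 2)
        (solve 2 (λ w s → let open Syntax w s in
                    (A′ :* w :^ 2 :+ B′ :* w :+ C′ :* w) :* s :+ Φ′ :* (w :* s)
                 := con 1 :* D′ :+ Φ′ :* (w :^ 2 :* s :+ w :* s :^ 3 :+ w :* s :^ 2)) refl ω t) ⟩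
      1# * D                                   ∎)

    multiplier-ω² : multiplier (ω ^ 2) ≡ 1#
    multiplier-ω² = *-cancelʳ D≢0 (trans (multiplier*D (ω ^ 2)) (≡-modulo-Φ
      (ω ^ 3 + ω ^ 2 * t ^ 2 + (1# + 1#) * ω * t)
      (ω ^ 4 + ω ^ 3 * t ^ 2 + (1# + 1#) * ω ^ 2 * t + ω * t ^ 2 + ω)
      (solve 2 (λ w s → let open Syntax w s in
                  A′ :* (w :^ 2) :^ 2 :+ B′ :* w :^ 2 :+ C′ :* w
                    :+ Φ′ :* (w :^ 3 :+ w :^ 2 :* s :^ 2 :+ (con 1 :+ con 1) :* w :* s)
               := con 1 :* D′ :+ Φ′ :* (w :^ 4 :+ w :^ 3 :* s :^ 2 :+ (con 1 :+ con 1) :* w :^ 2 :* s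
                                        :+ w :* s :^ 2 :+ w)) refl ω t)))

module Generator (F : FiniteField) {γ : FiniteField.Carrier F} (gen : FiniteField.IsGenerator F γ) where
  open FiniteField F
  open FieldProperties F

  private
    γ≢0 : γ ≢ 0#
    γ≢0 = proj₁ gen

    IsPeriod : ℕ → Set
    IsPeriod d = 0 < d × γ ^ d ≡ 1#

    γ^i≡γ^j⇒period : ∀ {i j} → i < j → γ ^ i ≡ γ ^ j → IsPeriod (j ∸ i)
    γ^i≡γ^j⇒period i<j γ^i≡γ^j = ℕₚ.m<n⇒0<n∸m i<j , x^i≡x^j⇒x^[j∸i]≡1 γ≢0 (ℕₚ.<⇒≤ i<j) γ^i≡γ^j

    some-period : ∃ IsPeriod
    some-period with pigeonhole ℕₚ.≤-refl (λ (i : Fin (suc card)) → index (γ ^ toℕ i))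
    ... | i , j , i<j , same-index = _ , γ^i≡γ^j⇒period i<j (index-injective same-index)

    least-period : Least IsPeriod
    least-period = least-witness (λ d → (0 ℕₚ.<? d) ×-dec (γ ^ d ≟ 1#)) _ (proj₂ some-period)

  order : ℕ
  order = proj₁ least-period

  0<order : 0 < order
  0<order = proj₁ (proj₁ (proj₂ least-period))

  instance
    order-nonZero : NonZero order
    order-nonZero = ℕ.>-nonZero 0<order

  γ^order≡1 : γ ^ order ≡ 1#
  γ^order≡1 = proj₂ (proj₁ (proj₂ least-period))

  private
    γ^i≢γ^j : ∀ {i j} → i < j → j < order → γ ^ i ≢ γ ^ j
    γ^i≢γ^j {i} {j} i<j j<order γ^i≡γ^j =
      proj₂ (proj₂ least-period) (ℕₚ.≤-<-trans (ℕₚ.m∸n≤m j i) j<order) (γ^i≡γ^j⇒period i<j γ^i≡γ^j)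

  γ^-injective : ∀ {i j} → i < order → j < order → γ ^ i ≡ γ ^ j → i ≡ j
  γ^-injective {i} {j} i<order j<order γ^i≡γ^j with ℕₚ.<-cmp i j
  ... | tri< i<j _ _ = contradiction γ^i≡γ^j (γ^i≢γ^j i<j j<order)
  ... | tri≈ _ i≡j _ = i≡j
  ... | tri> _ _ j<i = contradiction (sym γ^i≡γ^j) (γ^i≢γ^j j<i i<order)

  log : ∀ x → x ≢ 0# → ∃ λ i → i < order × γ ^ i ≡ x
  log x x≢0 with proj₂ gen x x≢0
  ... | i , γ^i≡x = i % order , m%n<n i order , trans (sym (x^n≡x^[n%p] order γ^order≡1 i)) γ^i≡x

  1+order≡card : suc order ≡ card
  1+order≡card = ↔⇒≡ (↔-trans (zero∪enumeration↔ (λ _ _ → refl) tt (γ ^_) (λ i → x^n≢0 i γ≢0)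
                                  γ^-injective (λ _ → tt) (λ x x≢0 _ → log x x≢0))
                       (↔-trans (×-identityʳ 0ℓ Carrier) (↔-sym enum)))

module Involution (F : FiniteField) {γ : FiniteField.Carrier F} (gen : FiniteField.IsGenerator F γ)
                  (m k : ℕ) (order≡m*3 : Generator.order F gen ≡ m ℕ.* 3) (k<m : k < m) where
  open FiniteField F
  open FieldProperties F
  open Generator F gen using (γ^order≡1; γ^-injective; log)
  open Decidable⇒UIP using (≡-irrelevant)
  open IsCommutativeRing isCommutativeRing using (*-assoc; *-identityˡ; *-identityʳ; zeroʳ)
  open ≡-Reasoning

  s : ℕ
  s = 3 ℕ.* k ℕ.+ 1

  ω t : Carrier
  ω = γ ^ m
  t = γ ^ s

  private
    γ^m*3≡1 : γ ^ (m ℕ.* 3) ≡ 1#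
    γ^m*3≡1 = subst (λ n → γ ^ n ≡ 1#) order≡m*3 γ^order≡1

    γ^-injective′ : ∀ {i j} → i < m ℕ.* 3 → j < m ℕ.* 3 → γ ^ i ≡ γ ^ j → i ≡ j
    γ^-injective′ i< j< = γ^-injective (subst (_ <_) (sym order≡m*3) i<) (subst (_ <_) (sym order≡m*3) j<)

    log′ : ∀ x → x ≢ 0# → ∃ λ i → i < m ℕ.* 3 × γ ^ i ≡ x
    log′ x x≢0 with log x x≢0
    ... | i , i<order , γ^i≡x = i , subst (i <_) order≡m*3 i<order , γ^i≡x

    0<m : 0 < m
    0<m = ℕₚ.≤-<-trans z≤n k<m

    m<m*3 : m < m ℕ.* 3
    m<m*3 = ℕₚ.m<m*n m 3 {{ℕ.>-nonZero 0<m}} (s≤s (s≤s z≤n))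

    s<m*3 : s < m ℕ.* 3
    s<m*3 = ℕₚ.≤-trans (ℕₚ.n≤1+n (suc s)) (ℕₚ.≤-trans (ℕₚ.≤-reflexive 2+s≡[1+k]*3) (ℕₚ.*-monoˡ-≤ 3 k<m))
      where
      2+s≡[1+k]*3 : 2 ℕ.+ (3 ℕ.* k ℕ.+ 1) ≡ suc k ℕ.* 3
      2+s≡[1+k]*3 = ℕ-solve (k ∷ [])

  ω³≡1 : ω ^ 3 ≡ 1#
  ω³≡1 = trans (^-*-assoc γ m 3) γ^m*3≡1

  ω≢1 : ω ≢ 1#
  ω≢1 ω≡1 = ℕₚ.<⇒≢ 0<m (sym (γ^-injective′ m<m*3 (ℕₚ.<-trans 0<m m<m*3) ω≡1))

  t≢1 : t ≢ 1#
  t≢1 t≡1 = ℕₚ.m+1+n≢0 (3 ℕ.* k) (γ^-injective′ s<m*3 (ℕₚ.<-trans 0<m m<m*3) t≡1)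

  t≢0 : t ≢ 0#
  t≢0 = x^n≢0 s (proj₁ gen)

  open CubeRoot ω³≡1 ω≢1
  open Interpolation 1+ω+ω²≡0 3≢0 ω≢0 t≢0

  t^m≡ω : t ^ m ≡ ω
  t^m≡ω = begin
    (γ ^ s) ^ m                 ≡⟨ ^-comm γ s m ⟩
    ω ^ (3 ℕ.* k ℕ.+ 1)         ≡⟨ cong (ω ^_) s≡1+k*3 ⟩
    ω ^ (1 ℕ.+ k ℕ.* 3)         ≡⟨ ω^[r+j*3]≡ω^r 1 k ⟩
    ω * 1#                      ≡⟨ *-identityʳ ω ⟩
    ω                           ∎
    where
    s≡1+k*3 : 3 ℕ.* k ℕ.+ 1 ≡ 1 ℕ.+ k ℕ.* 3
    s≡1+k*3 = ℕ-solve (k ∷ [])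

  γ^e≡ω^a*t^b : ∀ {e} a b → e ≡ m ℕ.* a ℕ.+ s ℕ.* b → γ ^ e ≡ ω ^ a * t ^ b
  γ^e≡ω^a*t^b a b refl = trans (^-distribˡ-+-* γ (m ℕ.* a) (s ℕ.* b))
                                (sym (cong₂ _*_ (^-*-assoc γ m a) (^-*-assoc γ s b)))
  private
    3γ^[m+s]≡D : 3# * γ ^ (m ℕ.+ 3 ℕ.* k ℕ.+ 1) ≡ D
    3γ^[m+s]≡D = cong (3# *_) (trans (cong (γ ^_) m+3k+1≡m+s) (^-distribˡ-+-* γ m s))
      where
      m+3k+1≡m+s : m ℕ.+ 3 ℕ.* k ℕ.+ 1 ≡ m ℕ.+ (3 ℕ.* k ℕ.+ 1)
      m+3k+1≡m+s = ℕ-solve (m ∷ k ∷ [])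

  coefA≡A÷D : coefA γ m k ≡ A ÷ D
  coefA≡A÷D = cong₂ _÷_
    (trans (cong₂ _+_ (cong₂ _+_ (γ^e≡ω^a*t^b 2 0 e₁) (γ^e≡ω^a*t^b 1 2 e₂)) (γ^e≡ω^a*t^b 0 1 e₃))
           (solve 2 (λ w τ → w :^ 2 :* τ :^ 0 :+ w :^ 1 :* τ :^ 2 :+ w :^ 0 :* τ :^ 1
                          := w :^ 2 :+ w :* τ :^ 2 :+ τ) refl ω t))
    3γ^[m+s]≡D
    where
    e₁ : 2 ℕ.* m ≡ m ℕ.* 2 ℕ.+ (3 ℕ.* k ℕ.+ 1) ℕ.* 0
    e₁ = ℕ-solve (m ∷ k ∷ [])
    e₂ : m ℕ.+ 6 ℕ.* k ℕ.+ 2 ≡ m ℕ.* 1 ℕ.+ (3 ℕ.* k ℕ.+ 1) ℕ.* 2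
    e₂ = ℕ-solve (m ∷ k ∷ [])
    e₃ : 3 ℕ.* k ℕ.+ 1 ≡ m ℕ.* 0 ℕ.+ (3 ℕ.* k ℕ.+ 1) ℕ.* 1
    e₃ = ℕ-solve (m ∷ k ∷ [])

  coefB≡B÷D : coefB γ m k ≡ B ÷ D
  coefB≡B÷D = cong₂ _÷_
    (trans (cong₂ _+_ (cong₂ _+_ (γ^e≡ω^a*t^b 2 1 e₁) (γ^e≡ω^a*t^b 1 2 e₂)) refl)
           (solve 2 (λ w τ → w :^ 2 :* τ :^ 1 :+ w :^ 1 :* τ :^ 2 :+ con 1
                          := w :^ 2 :* τ :+ w :* τ :^ 2 :+ con 1) refl ω t))
    3γ^[m+s]≡D
    where
    e₁ : 2 ℕ.* m ℕ.+ 3 ℕ.* k ℕ.+ 1 ≡ m ℕ.* 2 ℕ.+ (3 ℕ.* k ℕ.+ 1) ℕ.* 1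
    e₁ = ℕ-solve (m ∷ k ∷ [])
    e₂ : m ℕ.+ 6 ℕ.* k ℕ.+ 2 ≡ m ℕ.* 1 ℕ.+ (3 ℕ.* k ℕ.+ 1) ℕ.* 2
    e₂ = ℕ-solve (m ∷ k ∷ [])

  coefC≡C÷3t : coefC γ m k ≡ C ÷ (3# * t)
  coefC≡C÷3t = cong (_÷ (3# * t))
    (trans (cong (λ p → p + t + 1#) (γ^e≡ω^a*t^b 0 2 e))
           (solve 2 (λ w τ → w :^ 0 :* τ :^ 2 :+ τ :+ con 1 := τ :^ 2 :+ τ :+ con 1) refl ω t))
    where
    e : 6 ℕ.* k ℕ.+ 2 ≡ m ℕ.* 0 ℕ.+ (3 ℕ.* k ℕ.+ 1) ℕ.* 2
    e = ℕ-solve (m ∷ k ∷ [])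

  g : Carrier → Carrier
  g = gPoly γ m k

  g≡multiplier*x : ∀ {x u} → x ^ m ≡ u → g x ≡ multiplier u * x
  g≡multiplier*x {x} refl = begin
    g x
      ≡⟨ cong₂ (λ p q → a * p + b * q + c * x) x^[2m+1] (^-distribˡ-+-* x m 1) ⟩
    a * ((x ^ m) ^ 2 * x ^ 1) + b * (x ^ m * x ^ 1) + c * x
      ≡⟨ solve 5 (λ a b c u x → a :* (u :^ 2 :* x :^ 1) :+ b :* (u :* x :^ 1) :+ c :* x
                    := (a :* u :^ 2 :+ b :* u :+ c) :* x) refl a b c (x ^ m) x ⟩
    (a * (x ^ m) ^ 2 + b * x ^ m + c) * x
      ≡⟨ cong (_* x) (cong₂ _+_ (cong₂ (λ p q → p * (x ^ m) ^ 2 + q * x ^ m) coefA≡A÷D coefB≡B÷D) coefC≡C÷3t) ⟩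
    multiplier (x ^ m) * x
      ∎
    where
    a = coefA γ m k
    b = coefB γ m k
    c = coefC γ m k
    x^[2m+1] : x ^ (2 ℕ.* m ℕ.+ 1) ≡ (x ^ m) ^ 2 * x ^ 1
    x^[2m+1] = trans (^-distribˡ-+-* x (2 ℕ.* m) 1)
                     (cong (_* x ^ 1) (trans (cong (x ^_) (ℕₚ.*-comm 2 m)) (sym (^-*-assoc x m 2))))

  x^m-cubeRoot : ∀ {x} → x ≢ 0# → CubeRootOfUnity (x ^ m)
  x^m-cubeRoot {x} x≢0 with proj₂ gen x x≢0
  ... | i , refl = subst CubeRootOfUnity (^-comm γ m i) (ω^n-cubeRoot i)

  g-0 : g 0# ≡ 0#
  g-0 = trans (g≡multiplier*x refl) (zeroʳ _)

  g-on-1 : ∀ {x} → x ^ m ≡ 1# → g x ≡ t * x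
  g-on-1 {x} x^m≡1 = trans (g≡multiplier*x x^m≡1) (cong (_* x) multiplier-1)

  g-on-ω² : ∀ {x} → x ^ m ≡ ω ^ 2 → g x ≡ x
  g-on-ω² {x} x^m≡ω² = trans (g≡multiplier*x x^m≡ω²) (trans (cong (_* x) multiplier-ω²) (*-identityˡ x))

  private
    g-factor≡1 : ∀ {x c} → x ≢ 0# → g x ≡ c * x → g x ≡ x → c ≡ 1#
    g-factor≡1 {x} x≢0 gx≡cx gx≡x = *-cancelʳ x≢0 (trans (sym gx≡cx) (trans gx≡x (sym (*-identityˡ x))))

  g∘g-on-1 : ∀ {x} → x ^ m ≡ 1# → g (g x) ≡ x
  g∘g-on-1 {x} x^m≡1 = begin
    g (g x)                  ≡⟨ cong g (g-on-1 x^m≡1) ⟩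
    g (t * x)                ≡⟨ g≡multiplier*x [tx]^m≡ω ⟩
    multiplier ω * (t * x)   ≡⟨ *-assoc (multiplier ω) t x ⟨
    multiplier ω * t * x     ≡⟨ cong (_* x) multiplier-ω ⟩
    1# * x                   ≡⟨ *-identityˡ x ⟩
    x                        ∎
    where
    [tx]^m≡ω : (t * x) ^ m ≡ ω
    [tx]^m≡ω = trans (^-distribʳ-* t x m) (trans (cong₂ _*_ t^m≡ω x^m≡1) (*-identityʳ ω))

  g∘g-on-ω : ∀ {x} → x ^ m ≡ ω → g (g x) ≡ x
  g∘g-on-ω {x} x^m≡ω = begin
    g (g x)        ≡⟨ cong g (g≡multiplier*x x^m≡ω) ⟩
    g (μ * x)      ≡⟨ g-on-1 [μx]^m≡1 ⟩
    t * (μ * x)    ≡⟨ solve 3 (λ τ μ x → τ :* (μ :* x) := μ :* τ :* x) refl t μ x ⟩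
    μ * t * x      ≡⟨ cong (_* x) multiplier-ω ⟩
    1# * x         ≡⟨ *-identityˡ x ⟩
    x              ∎
    where
    μ = multiplier ω
    [μx]^m≡1 : (μ * x) ^ m ≡ 1#
    [μx]^m≡1 = begin
      (μ * x) ^ m      ≡⟨ ^-distribʳ-* μ x m ⟩
      μ ^ m * x ^ m    ≡⟨ cong (μ ^ m *_) (trans x^m≡ω (sym t^m≡ω)) ⟩
      μ ^ m * t ^ m    ≡⟨ ^-distribʳ-* μ t m ⟨
      (μ * t) ^ m      ≡⟨ cong (_^ m) multiplier-ω ⟩
      1# ^ m           ≡⟨ 1^n≡1 m ⟩
      1#               ∎

  g-involutive : ∀ x → g (g x) ≡ x
  g-involutive x with x ≟ 0#
  ... | yes refl = trans (cong g g-0) g-0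
  ... | no x≢0 with x^m-cubeRoot x≢0
  ...   | is-1 x^m≡1   = g∘g-on-1 x^m≡1
  ...   | is-ω x^m≡ω   = g∘g-on-ω x^m≡ω
  ...   | is-ω² x^m≡ω² = trans (cong g (g-on-ω² x^m≡ω²)) (g-on-ω² x^m≡ω²)

  g-selfInverse : ∀ {x y} → g x ≡ y → g y ≡ x
  g-selfInverse {x} gx≡y = trans (cong g (sym gx≡y)) (g-involutive x)

  g-fixed⇒x^m≡ω² : ∀ {x} → x ≢ 0# → g x ≡ x → x ^ m ≡ ω ^ 2
  g-fixed⇒x^m≡ω² {x} x≢0 gx≡x with x^m-cubeRoot x≢0
  ... | is-1 x^m≡1   = contradiction (g-factor≡1 x≢0 (g-on-1 x^m≡1) gx≡x) t≢1
  ... | is-ω x^m≡ω   = contradiction (begin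
    t                  ≡⟨ *-identityˡ t ⟨
    1# * t             ≡⟨ cong (_* t) (g-factor≡1 x≢0 (g≡multiplier*x x^m≡ω) gx≡x) ⟨
    multiplier ω * t   ≡⟨ multiplier-ω ⟩
    1#                 ∎) t≢1
  ... | is-ω² x^m≡ω² = x^m≡ω²

  IsFixed : Carrier → Set
  IsFixed x = g x ≡ x

  private
    [γ^[2+j*3]]^m≡ω² : ∀ j → (γ ^ (2 ℕ.+ j ℕ.* 3)) ^ m ≡ ω ^ 2
    [γ^[2+j*3]]^m≡ω² j = trans (^-comm γ (2 ℕ.+ j ℕ.* 3) m) (ω^[r+j*3]≡ω^r 2 j)

    2+j*3<m*3 : ∀ {j} → j < m → 2 ℕ.+ j ℕ.* 3 < m ℕ.* 3
    2+j*3<m*3 = ℕₚ.*-monoˡ-≤ 3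

    fixed⇒γ^[2+j*3] : ∀ x → x ≢ 0# → IsFixed x → ∃ λ j → j < m × γ ^ (2 ℕ.+ j ℕ.* 3) ≡ x
    fixed⇒γ^[2+j*3] x x≢0 gx≡x with log′ x x≢0
    ... | i , i<m*3 , refl = i / 3 , m<n*o⇒m/o<n i<m*3 , cong (γ ^_) 2+[i/3]*3≡i
      where
      i%3≡2 : i % 3 ≡ 2
      i%3≡2 = ω^r≡ω²⇒r≡2 (m%n<n i 3) (begin
        ω ^ (i % 3)                   ≡⟨ ω^[r+j*3]≡ω^r (i % 3) (i / 3) ⟨
        ω ^ (i % 3 ℕ.+ i / 3 ℕ.* 3)   ≡⟨ cong (ω ^_) (m≡m%n+[m/n]*n i 3) ⟨
        ω ^ i                         ≡⟨ ^-comm γ i m ⟨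
        (γ ^ i) ^ m                   ≡⟨ g-fixed⇒x^m≡ω² x≢0 gx≡x ⟩
        ω ^ 2                         ∎)
      2+[i/3]*3≡i : 2 ℕ.+ i / 3 ℕ.* 3 ≡ i
      2+[i/3]*3≡i = trans (cong (ℕ._+ i / 3 ℕ.* 3) (sym i%3≡2)) (sym (m≡m%n+[m/n]*n i 3))

  fixedPoints↔ : Fin (suc m) ↔ Σ Carrier IsFixed
  fixedPoints↔ = zero∪enumeration↔ (≡-irrelevant _≟_) g-0 (λ j → γ ^ (2 ℕ.+ j ℕ.* 3))
    (λ j → x^n≢0 (2 ℕ.+ j ℕ.* 3) (proj₁ gen))
    (λ j<m j′<m eq → ℕₚ.*-cancelʳ-≡ _ _ 3 (ℕₚ.+-cancelˡ-≡ 2 _ _ (γ^-injective′ (2+j*3<m*3 j<m) (2+j*3<m*3 j′<m) eq)))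
    (λ {j} _ → g-on-ω² ([γ^[2+j*3]]^m≡ω² j))
    fixed⇒γ^[2+j*3]

open FiniteField

theorem2p3 : (F : FiniteField) →
    card F % 2 ≡ 1 → card F % 3 ≡ 1 →
    (γ : Carrier F) → IsGenerator F γ →
    (k : ℕ) → k < (card F ∸ 1) / 3 →
      Bijective _≡_ _≡_ (gPoly F γ ((card F ∸ 1) / 3) k)
      × (∀ x → gPoly F γ ((card F ∸ 1) / 3) k (gPoly F γ ((card F ∸ 1) / 3) k x) ≡ x)
      × (Fin (suc ((card F ∸ 1) / 3)) ↔ Σ (Carrier F) (λ x → gPoly F γ ((card F ∸ 1) / 3) k x ≡ x))
theorem2p3 F _ q%3≡1 γ gen k k<m =
  selfInverse⇒bijective g-selfInverse , g-involutive , fixedPoints↔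
  where
  order≡m*3 : Generator.order F gen ≡ (card F ∸ 1) / 3 ℕ.* 3
  order≡m*3 = trans (cong (_∸ 1) (Generator.1+order≡card F gen)) (sym (m/n*n≡m (3∣n∸1 {card F} q%3≡1)))

  open Involution F gen ((card F ∸ 1) / 3) k order≡m*3 k<m
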